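{- Let $n$ be a positive integer and let $G$ be any graph with at most $n$ vertices. Then $\chi_{td}(G) \leq 3^{\lceil \log_2 n \rceil}$.
   Context: For a graph $G$ and a positive integer $k$, a proper $k$-total difference labeling of $G$ is a function $f$ from $V(G)\cup E(G)$ to $\{1,2,\dots,k\}$ such that: (1) for every edge $\{u,v\}$, $f(\{u,v\})=|f(u)-f(v)|$; (2) adjacent vertices receive different labels; (3) two edges sharing a vertex receive different labels; (4) no edge receives the same label as one of its endpoints. $\chi_{td}(G)$ denotes the smallest $k$ for which $G$ has a proper $k$-total difference labeling. -}

module Defs where

open import Level using (0ℓ)
open import Data.Nat using (ℕ; _≤_; ∣_-_∣)
open import Data.Fin using (Fin)
open import Data.Product using (Σ; _×_)
open import Relation.Binary.PropositionalEquality using (_≡_; _≢_)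
open import Relation.Nullary using (¬_)

record Graph (m : ℕ) : Set₁ where
  field
    Adj   : Fin m → Fin m → Set
    sym   : ∀ {u v} → Adj u v → Adj v u
    irrefl : ∀ {u} → ¬ Adj u u
open Graph public

-- A total labeling is determined by the vertex labels f; the label of
-- edge {u,v} is forced by condition (1) to be |f u - f v|.
edgeLabel : ∀ {m} → (Fin m → ℕ) → Fin m → Fin m → ℕ
edgeLabel f u v = ∣ f u - f v ∣

record IsProperTDL {m : ℕ} (G : Graph m) (k : ℕ) (f : Fin m → ℕ) : Set where
  field
    vertexRange : ∀ v → 1 ≤ f v × f v ≤ k
    edgeRange   : ∀ u v → Adj G u v → 1 ≤ edgeLabel f u v × edgeLabel f u v ≤ k
    adjDistinct : ∀ u v → Adj G u v → f u ≢ f v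
    edgeDistinct : ∀ u v w → Adj G u v → Adj G u w → v ≢ w →
                   edgeLabel f u v ≢ edgeLabel f u w
    edgeVertex  : ∀ u v → Adj G u v → edgeLabel f u v ≢ f u

-- χ_td(G) ≤ K : there is k ≤ K admitting a proper k-total difference labeling
-- (χ_td is the least such k).
χtd≤ : ∀ {m} → Graph m → ℕ → Set
χtd≤ {m} G K = Σ ℕ λ k → k ≤ K × Σ (Fin m → ℕ) λ f → IsProperTDL G k f

-- Label vertex v by c + t(v), where t(v) is an injective choice of numbers
-- whose base-3 digits are all 0 or 1, and c = 1 + max t.  Such numbers contain
-- no three-term arithmetic progression (adding two of them in base 3 produces
-- no carries), and all labels lie in [c, 2c).  Two edges at u with equal labels
-- would have far endpoints labelled f(u) ± δ, a progression; an edge labelled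
-- f(u) would have its other endpoint labelled 0 or 2f(u) ≥ 2c.  With
-- d = ⌈log₂ n⌉ digits there are 2^d ≥ n such labels, all at most 3^d.
module Submission where

open import Defs
open import Data.Nat
  using (ℕ; zero; suc; _+_; _*_; _^_; _≤_; _<_; z≤n; s≤s; NonZero; ⌊_/2⌋; ⌈_/2⌉; ∣_-_∣)
open import Data.Nat.Properties
open import Data.Nat.DivMod using (_%_; [m+kn]%n≡m%n; m<n⇒m%n≡m)
open import Data.Nat.Induction using (<-rec)
open import Data.Nat.Logarithm using (⌈log₂_⌉)
open import Data.Nat.Logarithm.Core using (⌈log2⌉-acc-irrelevant)
open import Data.Nat.Tactic.RingSolver using (solve-∀)
import Data.Fin as Fin
open import Data.Fin using (Fin; toℕ; inject≤; combine; finToFun; funToFin)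
open import Data.Fin.Properties using (toℕ≤pred[n]; inject≤-injective; funToFin-finToFin)
open import Data.Product using (_×_; _,_; proj₁; proj₂)
open import Data.Sum using (_⊎_; inj₁; inj₂)
open import Function using (_∘_)
open import Relation.Binary.PropositionalEquality
  using (_≡_; _≢_; _≗_; refl; cong; cong₂; trans; module ≡-Reasoning)
  renaming (sym to ≡-sym)

⌈log₂[2+n]⌉≡1+⌈log₂⌈[2+n]/2⌉⌉ : ∀ n → ⌈log₂ suc (suc n) ⌉ ≡ suc ⌈log₂ ⌈ suc (suc n) /2⌉ ⌉
⌈log₂[2+n]⌉≡1+⌈log₂⌈[2+n]/2⌉⌉ n = cong suc (⌈log2⌉-acc-irrelevant (suc ⌈ n /2⌉))

n≤⌈n/2⌉+⌈n/2⌉ : ∀ n → n ≤ ⌈ n /2⌉ + ⌈ n /2⌉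
n≤⌈n/2⌉+⌈n/2⌉ n = begin
  n                     ≡⟨ ⌊n/2⌋+⌈n/2⌉≡n n ⟨
  ⌊ n /2⌋ + ⌈ n /2⌉     ≤⟨ +-monoˡ-≤ ⌈ n /2⌉ (⌊n/2⌋≤⌈n/2⌉ n) ⟩
  ⌈ n /2⌉ + ⌈ n /2⌉     ∎
  where open ≤-Reasoning

n≤2^⌈log₂n⌉ : ∀ n → n ≤ 2 ^ ⌈log₂ n ⌉
n≤2^⌈log₂n⌉ = <-rec _ step
  where
  step : ∀ n → (∀ {m} → m < n → m ≤ 2 ^ ⌈log₂ m ⌉) → n ≤ 2 ^ ⌈log₂ n ⌉
  step zero          _  = z≤n
  step (suc zero)    _  = s≤s z≤n
  step (suc (suc n)) ih = begin
    suc (suc n)             ≤⟨ n≤⌈n/2⌉+⌈n/2⌉ (suc (suc n)) ⟩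
    h + h                   ≤⟨ +-mono-≤ (ih (⌈n/2⌉<n n)) (ih (⌈n/2⌉<n n)) ⟩
    2 ^ L + 2 ^ L           ≡⟨ cong (2 ^ L +_) (+-identityʳ (2 ^ L)) ⟨
    2 ^ suc L               ≡⟨ cong (2 ^_) (⌈log₂[2+n]⌉≡1+⌈log₂⌈[2+n]/2⌉⌉ n) ⟨
    2 ^ ⌈log₂ suc (suc n) ⌉ ∎
    where
    open ≤-Reasoning
    h = ⌈ suc (suc n) /2⌉
    L = ⌈log₂ h ⌉

m≡n+∣m-n∣⊎n≡m+∣m-n∣ : ∀ m n → m ≡ n + ∣ m - n ∣ ⊎ n ≡ m + ∣ m - n ∣
m≡n+∣m-n∣⊎n≡m+∣m-n∣ m n with ≤-total n m
... | inj₁ n≤m = inj₁ (≡-sym (trans (cong (n +_) (m≤n⇒∣n-m∣≡n∸m n≤m)) (m+[n∸m]≡n n≤m)))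
... | inj₂ m≤n = inj₂ (≡-sym (trans (cong (m +_) (m≤n⇒∣m-n∣≡n∸m m≤n)) (m+[n∸m]≡n m≤n)))

m≡n+d⇒o≡m+d⇒n+o≡m+m : ∀ {m n o d} → m ≡ n + d → o ≡ m + d → n + o ≡ m + m
m≡n+d⇒o≡m+d⇒n+o≡m+m {n = n} {d = d} refl refl = rearrange n d
  where
  rearrange : ∀ n d → n + (n + d + d) ≡ n + d + (n + d)
  rearrange = solve-∀

∣m-n∣≡∣m-o∣⇒n≡o⊎n+o≡m+m : ∀ m n o → ∣ m - n ∣ ≡ ∣ m - o ∣ → n ≡ o ⊎ n + o ≡ m + m
∣m-n∣≡∣m-o∣⇒n≡o⊎n+o≡m+m m n o eq
  with m≡n+∣m-n∣⊎n≡m+∣m-n∣ m n | m≡n+∣m-n∣⊎n≡m+∣m-n∣ m o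
... | inj₁ p | inj₁ q =
  inj₁ (+-cancelʳ-≡ ∣ m - n ∣ n o (trans (≡-sym p) (trans q (cong (o +_) (≡-sym eq)))))
... | inj₂ p | inj₂ q = inj₁ (trans p (trans (cong (m +_) eq) (≡-sym q)))
... | inj₁ p | inj₂ q = inj₂ (m≡n+d⇒o≡m+d⇒n+o≡m+m p (trans q (cong (m +_) (≡-sym eq))))
... | inj₂ p | inj₁ q =
  inj₂ (trans (+-comm n o) (m≡n+d⇒o≡m+d⇒n+o≡m+m (trans q (cong (o +_) (≡-sym eq))) p))

∣m-n∣≡m⇒n≡0⊎n≡m+m : ∀ m n → ∣ m - n ∣ ≡ m → n ≡ 0 ⊎ n ≡ m + m
∣m-n∣≡m⇒n≡0⊎n≡m+m m n eq with m≡n+∣m-n∣⊎n≡m+∣m-n∣ m n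
... | inj₁ p = inj₁ (+-cancelʳ-≡ m n 0 (≡-sym (trans p (cong (n +_) eq))))
... | inj₂ p = inj₂ (trans p (cong (m +_) eq))

euclidean-division-unique : ∀ {b} .{{_ : NonZero b}} r s q q′ → r < b → s < b →
                            r + q * b ≡ s + q′ * b → r ≡ s × q ≡ q′
euclidean-division-unique {b} r s q q′ r<b s<b eq = r≡s , q≡q′
  where
  open ≡-Reasoning
  r≡s : r ≡ s
  r≡s = begin
    r                ≡⟨ m<n⇒m%n≡m r<b ⟨
    r % b            ≡⟨ [m+kn]%n≡m%n r q b ⟨
    (r + q * b) % b  ≡⟨ cong (_% b) eq ⟩
    (s + q′ * b) % b ≡⟨ [m+kn]%n≡m%n s q′ b ⟩
    s % b            ≡⟨ m<n⇒m%n≡m s<b ⟩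
    s                ∎
  q≡q′ : q ≡ q′
  q≡q′ = *-cancelʳ-≡ q q′ b (+-cancelˡ-≡ s _ _ (trans (cong (_+ q * b) (≡-sym r≡s)) eq))

-- The natural number whose base-3 digits (least significant first) are the
-- binary digits φ.
ternary : ∀ {d} → (Fin d → Fin 2) → ℕ
ternary {zero}  _ = 0
ternary {suc d} φ = toℕ (φ Fin.zero) + ternary (φ ∘ Fin.suc) * 3

repunit₃ : ℕ → ℕ
repunit₃ zero    = 0
repunit₃ (suc d) = 1 + repunit₃ d * 3

ternary≤repunit₃ : ∀ {d} (φ : Fin d → Fin 2) → ternary φ ≤ repunit₃ d
ternary≤repunit₃ {zero}  φ = z≤n
ternary≤repunit₃ {suc d} φ =
  +-mono-≤ (toℕ≤pred[n] (φ Fin.zero)) (*-monoˡ-≤ 3 (ternary≤repunit₃ (φ ∘ Fin.suc)))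

3^d≡1+repunit₃+repunit₃ : ∀ d → 3 ^ d ≡ suc (repunit₃ d + repunit₃ d)
3^d≡1+repunit₃+repunit₃ zero    = refl
3^d≡1+repunit₃+repunit₃ (suc d) =
  trans (cong (3 *_) (3^d≡1+repunit₃+repunit₃ d)) (rearrange (repunit₃ d))
  where
  rearrange : ∀ r → 3 * suc (r + r) ≡ suc ((1 + r * 3) + (1 + r * 3))
  rearrange = solve-∀

binary-digit-midpoint : (a b c : Fin 2) → toℕ a + toℕ b ≡ toℕ c + toℕ c → a ≡ b
binary-digit-midpoint Fin.zero           Fin.zero           _                  _  = refl
binary-digit-midpoint (Fin.suc Fin.zero) (Fin.suc Fin.zero) _                  _  = refl
binary-digit-midpoint Fin.zero           (Fin.suc Fin.zero) Fin.zero           ()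
binary-digit-midpoint Fin.zero           (Fin.suc Fin.zero) (Fin.suc Fin.zero) ()
binary-digit-midpoint (Fin.suc Fin.zero) Fin.zero           Fin.zero           ()
binary-digit-midpoint (Fin.suc Fin.zero) Fin.zero           (Fin.suc Fin.zero) ()

ternary-progressionFree : ∀ {d} (φ ψ χ : Fin d → Fin 2) →
                          ternary φ + ternary ψ ≡ ternary χ + ternary χ → φ ≗ ψ
ternary-progressionFree {zero}  _ _ _ _ ()
ternary-progressionFree {suc d} φ ψ χ eq = digitwise
  where
  interchange : ∀ a x b y → (a + x * 3) + (b + y * 3) ≡ (a + b) + (x + y) * 3
  interchange = solve-∀
  digitSum<3 : ∀ (a b : Fin 2) → toℕ a + toℕ b < 3
  digitSum<3 a b = s≤s (+-mono-≤ (toℕ≤pred[n] a) (toℕ≤pred[n] b))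
  a = φ Fin.zero ; b = ψ Fin.zero ; c = χ Fin.zero
  φ′ = φ ∘ Fin.suc ; ψ′ = ψ ∘ Fin.suc ; χ′ = χ ∘ Fin.suc
  split : toℕ a + toℕ b ≡ toℕ c + toℕ c × ternary φ′ + ternary ψ′ ≡ ternary χ′ + ternary χ′
  split = euclidean-division-unique _ _ _ _ (digitSum<3 a b) (digitSum<3 c c)
    (begin
      toℕ a + toℕ b + (ternary φ′ + ternary ψ′) * 3 ≡⟨ interchange (toℕ a) (ternary φ′) (toℕ b) (ternary ψ′) ⟨
      ternary φ + ternary ψ                         ≡⟨ eq ⟩
      ternary χ + ternary χ                         ≡⟨ interchange (toℕ c) (ternary χ′) (toℕ c) (ternary χ′) ⟩
      toℕ c + toℕ c + (ternary χ′ + ternary χ′) * 3 ∎)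
    where open ≡-Reasoning
  digitwise : φ ≗ ψ
  digitwise Fin.zero    = binary-digit-midpoint a b c (proj₁ split)
  digitwise (Fin.suc i) = ternary-progressionFree φ′ ψ′ χ′ (proj₂ split) i

funToFin-cong : ∀ {m n} {φ ψ : Fin m → Fin n} → φ ≗ ψ → funToFin φ ≡ funToFin ψ
funToFin-cong {zero}  _     = refl
funToFin-cong {suc m} φ≗ψ = cong₂ combine (φ≗ψ Fin.zero) (funToFin-cong (φ≗ψ ∘ Fin.suc))

finToFun-injective : ∀ {m n} (i j : Fin (m ^ n)) → finToFun i ≗ finToFun j → i ≡ j
finToFun-injective {m} {n} i j eq = begin
  i                             ≡⟨ funToFin-finToFin {n} {m} i ⟨
  funToFin (finToFun {m} {n} i) ≡⟨ funToFin-cong {n} {m} eq ⟩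
  funToFin (finToFun {m} {n} j) ≡⟨ funToFin-finToFin {n} {m} j ⟩
  j                             ∎
  where open ≡-Reasoning

ProgressionFree : ∀ {m} → (Fin m → ℕ) → Set
ProgressionFree f = ∀ u v w → f u + f v ≡ f w + f w → u ≡ v

progressionFree⇒injective : ∀ {m} {f : Fin m → ℕ} → ProgressionFree f →
                            ∀ u v → f u ≡ f v → u ≡ v
progressionFree⇒injective {f = f} free u v eq = free u v v (cong (_+ f v) eq)

progressionFree⇒properTDL : ∀ {m} (G : Graph m) {c k} (f : Fin m → ℕ) →
                            1 ≤ c → k < c + c → (∀ v → c ≤ f v × f v ≤ k) →
                            ProgressionFree f → IsProperTDL G k f
progressionFree⇒properTDL G {c} {k} f 1≤c k<2c range free = record
  { vertexRange  = λ v → ≤-trans 1≤c (proj₁ (range v)) , proj₂ (range v)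
  ; edgeRange    = λ u v uv →
      m≢n⇒1≤∣m-n∣ (adjDistinct′ u v uv) ,
      ≤-trans (∣m-n∣≤m⊔n (f u) (f v)) (⊔-lub (proj₂ (range u)) (proj₂ (range v)))
  ; adjDistinct  = adjDistinct′
  ; edgeDistinct = edgeDistinct′
  ; edgeVertex   = edgeVertex′
  }
  where
  m≢n⇒1≤∣m-n∣ : ∀ {m n} → m ≢ n → 1 ≤ ∣ m - n ∣
  m≢n⇒1≤∣m-n∣ m≢n = n≢0⇒n>0 (m≢n ∘ ∣m-n∣≡0⇒m≡n)
  adjDistinct′ : ∀ u v → Adj G u v → f u ≢ f v
  adjDistinct′ u v uv fu≡fv with progressionFree⇒injective free u v fu≡fv
  ... | refl = irrefl G uv
  edgeDistinct′ : ∀ u v w → Adj G u v → Adj G u w → v ≢ w → edgeLabel f u v ≢ edgeLabel f u w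
  edgeDistinct′ u v w _ _ v≢w eq with ∣m-n∣≡∣m-o∣⇒n≡o⊎n+o≡m+m (f u) (f v) (f w) eq
  ... | inj₁ fv≡fw  = v≢w (progressionFree⇒injective free v w fv≡fw)
  ... | inj₂ mirror = v≢w (free v w u mirror)
  edgeVertex′ : ∀ u v → Adj G u v → edgeLabel f u v ≢ f u
  edgeVertex′ u v _ eq with ∣m-n∣≡m⇒n≡0⊎n≡m+m (f u) (f v) eq
  ... | inj₁ fv≡0   = n>0⇒n≢0 (≤-trans 1≤c (proj₁ (range v))) fv≡0
  ... | inj₂ fv≡2fu = <⇒≱ k<2c (begin
    c + c       ≤⟨ +-mono-≤ (proj₁ (range u)) (proj₁ (range u)) ⟩
    f u + f u   ≡⟨ fv≡2fu ⟨
    f v         ≤⟨ proj₂ (range v) ⟩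
    k           ∎)
    where open ≤-Reasoning

ternaryLabel-properTDL : ∀ {m} (G : Graph m) d (code : Fin m → Fin d → Fin 2) →
                         (∀ u v → code u ≗ code v → u ≡ v) →
                         IsProperTDL G (3 ^ d) (λ v → suc (repunit₃ d) + ternary (code v))
ternaryLabel-properTDL G d code code-injective =
  progressionFree⇒properTDL G f (s≤s z≤n) 3^d<c+c range free
  where
  c = suc (repunit₃ d)
  f = λ v → c + ternary (code v)
  3^d<c+c : 3 ^ d < c + c
  3^d<c+c = s≤s (≤-reflexive (trans (3^d≡1+repunit₃+repunit₃ d) (≡-sym (+-suc _ _))))
  range : ∀ v → c ≤ f v × f v ≤ 3 ^ d
  range v = m≤m+n c _ , ≤-trans (+-monoʳ-≤ c (ternary≤repunit₃ (code v)))
                                (≤-reflexive (≡-sym (3^d≡1+repunit₃+repunit₃ d)))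
  interchange : ∀ c x y → (c + x) + (c + y) ≡ (c + c) + (x + y)
  interchange = solve-∀
  free : ProgressionFree f
  free u v w eq = code-injective u v (ternary-progressionFree (code u) (code v) (code w)
    (+-cancelˡ-≡ (c + c) _ _ (trans (≡-sym (interchange c _ _)) (trans eq (interchange c _ _)))))

mainTheorem1 : (n : ℕ) → .{{_ : NonZero n}} → (m : ℕ) → m ≤ n → (G : Graph m) →
                 χtd≤ G (3 ^ ⌈log₂ n ⌉)
mainTheorem1 n m m≤n G = 3 ^ d , ≤-refl , _ , ternaryLabel-properTDL G d code code-injective
  where
  d = ⌈log₂ n ⌉
  m≤2^d : m ≤ 2 ^ d
  m≤2^d = ≤-trans m≤n (n≤2^⌈log₂n⌉ n)
  code : Fin m → Fin d → Fin 2
  code v = finToFun (inject≤ v m≤2^d)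
  code-injective : ∀ u v → code u ≗ code v → u ≡ v
  code-injective u v eq = inject≤-injective m≤2^d m≤2^d u v (finToFun-injective _ _ eq)
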